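{- Let $G^0$ be a digraph, $k,d\in\mathbb{N}$, and $\mathcal{P}=\{V_{ij}:i,j\in[k]\}$ a partition of $V(G^0)$ such that for all $i\in[k]$, $e(G^0_{i*})-e(G^0_{*i})=d(|V_{i*}|-|V_{*i}|)$. Then there exist a bijection $\sigma:[k]\to[k]$ and a subdigraph $G$ of $\mathcal{B}(G^0,\mathcal{P})$ such that $$e(G)\le d(k-1)\sum_{i\in[k]}\big||V_{i*}|-|V_{*i}|\big|/2,\qquad e(G_{i*})-e(G_{*i})=d(|V_{i*}|-|V_{*i}|)\ \text{for all } i\in[k],$$ and $e(G_{ji})=0$ for all $i,j\in[k]$ with $\sigma(i)\le\sigma(j)$.
   Context: $V_{i*}=\bigcup_jV_{ij}$, $V_{*i}=\bigcup_jV_{ji}$. For a digraph $G$ on $V(G^0)$ and $i,j\in[k]$, $G_{ij}$ is the subdigraph with vertex set $V_{i*}\cup V_{*j}$ and edge set the edges of $G$ from $V_{i*}$ to $V_{*j}$; $G_{i*}=\bigcup_{j\ne i}G_{ij}$ and $G_{*j}=\bigcup_{i\ne j}G_{ij}$. $\mathcal{B}(G^0,\mathcal{P})=G^0-\bigcup_{i\in[k]}E(G^0_{ii})$. (The bijection $\sigma$ encodes the paper's "by reordering $[k]$ if necessary", after which $e(G_{ji})=0$ for $i\le j$.) -}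

module Defs where

open import Data.Nat using (ℕ; zero; suc)
open import Data.Bool using (Bool; true; false; _∧_; not; if_then_else_)
open import Data.Fin using (Fin; _≟_)
open import Data.List using (List; map; allFin)
open import Data.Nat.ListAction using (sum)
open import Data.Product using (_×_; proj₁; proj₂)
open import Relation.Nullary.Decidable using (⌊_⌋)
open import Relation.Binary.PropositionalEquality using (_≡_)

-- A digraph on vertex set Fin n: adjacency (u , v) means an edge u → v.
-- No loops; at most one edge per ordered pair (adjacency is Bool-valued).
record Digraph (n : ℕ) : Set where
  field
    adj      : Fin n → Fin n → Bool
    loopless : ∀ v → adj v v ≡ false
open Digraph public

_⊆ᴰ_ : ∀ {n} → Digraph n → Digraph n → Set
G ⊆ᴰ H = ∀ u v → adj G u v ≡ true → adj H u v ≡ true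

-- A partition P = {V_ij : i,j ∈ [k]} of V(G^0) = Fin n, given by the map
-- sending each vertex v to the unique (i , j) with v ∈ V_ij.
Partition : ℕ → ℕ → Set
Partition n k = Fin n → Fin k × Fin k

countV : ∀ {n} → (Fin n → Bool) → ℕ
countV {n} p = sum (map (λ u → if p u then 1 else 0) (allFin n))

countE : ∀ {n} → (Fin n → Fin n → Bool) → ℕ
countE {n} p = sum (map (λ u → countV (p u)) (allFin n))

_==_ : ∀ {k} → Fin k → Fin k → Bool
i == j = ⌊ i ≟ j ⌋

module _ {n k : ℕ} (P : Partition n k) where
  inRow : Fin k → Fin n → Bool
  inRow i v = proj₁ (P v) == i
  inCol : Fin k → Fin n → Bool
  inCol i v = proj₂ (P v) == i

  sizeRow : Fin k → ℕ
  sizeRow i = countV (inRow i)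
  sizeCol : Fin k → ℕ
  sizeCol i = countV (inCol i)

  -- e(G_ij): edges of G from V_{i*} to V_{*j}
  eIJ : Digraph n → Fin k → Fin k → ℕ
  eIJ G i j = countE (λ u v → adj G u v ∧ inRow i u ∧ inCol j v)

  -- e(G_{i*}) where G_{i*} = ⋃_{j ≠ i} G_ij : edges from V_{i*} to ⋃_{j≠i} V_{*j}
  eOut : Digraph n → Fin k → ℕ
  eOut G i = countE (λ u v → adj G u v ∧ inRow i u ∧ not (inCol i v))

  -- e(G_{*i}) where G_{*i} = ⋃_{j ≠ i} G_ji : edges from ⋃_{j≠i} V_{j*} to V_{*i}
  eIn : Digraph n → Fin k → ℕ
  eIn G i = countE (λ u v → adj G u v ∧ not (inRow i u) ∧ inCol i v)

  -- B(G^0, P) = G^0 - ⋃_i E(G^0_ii)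
  bip : Digraph n → Digraph n
  adj (bip G) u v = adj G u v ∧ not (proj₁ (P u) == proj₂ (P v))
  loopless (bip G) v rewrite loopless G v = Relation.Binary.PropositionalEquality.refl

module Submission where

-- Replace G⁰ by B(G⁰,P): diagonal edges enter neither e(G_{i*}) nor e(G_{*i}), so the net degrees
-- e(G_{i*}) − e(G_{*i}) are unchanged. Now consider the quotient digraph on [k] with an arc a → b
-- whenever G has an edge from V_{a*} to V_{*b}. If it contains a cycle, delete one edge of G for each
-- arc of a simple cycle: every part loses one outgoing and one incoming edge, so the net degrees stay
-- the same while e(G) drops. Otherwise the quotient digraph is acyclic and longest-walk levels give a
-- topological order σ. Weighting part i by its position w i = σ(i) ∈ [0, k − 1], every edge of the final
-- G goes up by at least 1, hence
--   e(G) ≤ Σᵢ wᵢ (e(G_{*i}) − e(G_{i*})) = d Σᵢ wᵢ (|V_{*i}| − |V_{i*}|) ≤ d (k − 1) Σᵢ (|V_{*i}| − |V_{i*}|)⁺,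
-- and since Σᵢ |V_{i*}| = Σᵢ |V_{*i}|, the last sum is half of Σᵢ ||V_{i*}| − |V_{*i}||.

open import Defs
open import Data.Bool using (Bool; true; false; _∧_; not; if_then_else_)
open import Data.Bool.Properties using (∧-assoc; ∧-identityʳ; ∧-zeroʳ)
open import Data.Fin using (Fin; zero; suc; _≟_; toℕ; fromℕ<; punchOut) renaming (_≤_ to _≤ᶠ_; _<_ to _<ᶠ_)
open import Data.Fin.Properties
  using (all?; any?; ¬∀⟶∃¬; injective⇒≤; punchOut-injective; toℕ-injective; toℕ<n; toℕ-fromℕ<)
open import Data.Integer using (ℤ; +_; _-_; _*_; ∣_∣) renaming (_+_ to _+ᶻ_)
import Data.Integer.Properties as ℤ
open import Data.Integer.Tactic.RingSolver using () renaming (solve-∀ to solve-ℤ)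
open import Data.List using (List; []; _∷_; _++_; [_]; length; lookup; map; tabulate; allFin)
open import Data.List.Extrema.Nat using (argmax; f[xs]≤f[argmax])
open import Data.List.Membership.DecPropositional using () renaming (_∈?_ to ∈?)
open import Data.List.Membership.Propositional using (_∈_)
open import Data.List.Membership.Propositional.Properties using (∈-allFin; ∈-lookup; ∈-++⁺ʳ)
open import Data.List.Properties using (map-cong; length-++)
open import Data.List.Relation.Unary.All as All using (All; []; _∷_)
open import Data.List.Relation.Unary.All.Properties using (¬Any⇒All¬; ++⁻ˡ)
open import Data.List.Relation.Unary.Any using (here; there)
open import Data.List.Relation.Unary.Unique.Propositional using (Unique; []; _∷_)
open import Data.Nat using (ℕ; zero; suc; _+_; _∸_; _≤_; _<_; _≤?_; _<?_; z≤n; s≤s) renaming (_*_ to _*ℕ_)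
open import Data.Nat.ListAction using (sum)
open import Data.Nat.Properties hiding (_≟_)
open import Data.Nat.Tactic.RingSolver using () renaming (solve-∀ to solve-ℕ)
open import Algebra.Properties.Semiring.Sum +-*-semiring
  using (∑-distrib-+; ∑-comm; *-distribˡ-sum; *-distribʳ-sum; sum-cong-≗; sum-replicate-zero; sum-syntax)
  renaming (sum to ∑)
open import Data.Product using (Σ; ∃; ∃₂; _×_; _,_; proj₁; proj₂)
open import Data.Sum using (_⊎_; inj₁; inj₂)
open import Function using (_∘_; id; Injective; Surjective)
open import Function.Bundles using (_⤖_; Bijection; mk⤖)
open import Relation.Binary.Definitions using (Decidable; DecidableEquality; tri<; tri≈; tri>)
open import Relation.Binary.PropositionalEquality
  using (_≡_; _≢_; refl; sym; trans; cong; cong₂; subst; subst₂; module ≡-Reasoning)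
open import Relation.Nullary using (Dec; yes; no; ¬_; does; contradiction)
open import Relation.Nullary.Decidable using (dec-true; dec-false)

-- Indicators and finite sums

module _ {k : ℕ} where

  ==-refl : (x : Fin k) → (x == x) ≡ true
  ==-refl x with x ≟ x
  ... | yes _ = refl
  ... | no x≢x = contradiction refl x≢x

  ==⇒≡ : {x y : Fin k} → (x == y) ≡ true → x ≡ y
  ==⇒≡ {x} {y} e with x ≟ y
  ==⇒≡ _  | yes x≡y = x≡y
  ==⇒≡ () | no _

  ≢⇒==-false : {x y : Fin k} → x ≢ y → (x == y) ≡ false
  ≢⇒==-false {x} {y} x≢y with x ≟ y
  ... | yes x≡y = contradiction x≡y x≢y
  ... | no _ = refl

  -- Not refl: ⌊_⌋ does not compute through the map′ in the definition of Fin's _≟_.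
  ==-suc : (x y : Fin k) → (Fin.suc x == suc y) ≡ (x == y)
  ==-suc x y with x ≟ y
  ... | yes _ = refl
  ... | no _ = refl

⟦_⟧ : Bool → ℕ
⟦ b ⟧ = if b then 1 else 0

⟦⟧≤1 : ∀ b → ⟦ b ⟧ ≤ 1
⟦⟧≤1 true = ≤-refl
⟦⟧≤1 false = z≤n

⟦does⟧-mono : ∀ {A B : Set} (a? : Dec A) (b? : Dec B) → (A → B) → ⟦ does a? ⟧ ≤ ⟦ does b? ⟧
⟦does⟧-mono (no _) _ _ = z≤n
⟦does⟧-mono (yes _) (yes _) _ = ≤-refl
⟦does⟧-mono (yes a) (no ¬b) a⇒b = contradiction (a⇒b a) ¬b

∧≡true⇒× : ∀ {x y} → x ∧ y ≡ true → x ≡ true × y ≡ true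
∧≡true⇒× {true} {true} _ = refl , refl

⟦⟧-pos⇒true : ∀ {b} → 0 < ⟦ b ⟧ → b ≡ true
⟦⟧-pos⇒true {true} _ = refl

sum-map-tabulate : ∀ {A : Set} {n} (f : A → ℕ) (g : Fin n → A) → sum (map f (tabulate g)) ≡ ∑ (f ∘ g)
sum-map-tabulate {n = zero} f g = refl
sum-map-tabulate {n = suc n} f g = cong (_+_ (f (g zero))) (sum-map-tabulate f (g ∘ suc))

∑-δ : ∀ {k} (x : Fin k) (f : Fin k → ℕ) → ∑[ i < k ] (⟦ x == i ⟧ *ℕ f i) ≡ f x
∑-δ {suc k} zero f = trans (cong₂ _+_ (*-identityˡ (f zero)) (sum-replicate-zero k)) (+-identityʳ _)
∑-δ {suc k} (suc x) f =
  trans (sum-cong-≗ (λ i → cong (λ b → ⟦ b ⟧ *ℕ f (suc i)) (==-suc x i))) (∑-δ x (λ i → f (suc i)))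

∑-point : ∀ {k} {f g : Fin k → ℕ} (x : Fin k) (c : ℕ) → (∀ i → f i ≡ g i + ⟦ x == i ⟧ *ℕ c) → ∑ f ≡ ∑ g + c
∑-point {f = f} {g} x c f≡g+δc = begin
  ∑ f                              ≡⟨ sum-cong-≗ f≡g+δc ⟩
  ∑ (λ i → g i + ⟦ x == i ⟧ *ℕ c)  ≡⟨ ∑-distrib-+ g _ ⟩
  ∑ g + ∑ (λ i → ⟦ x == i ⟧ *ℕ c)  ≡⟨ cong (_+_ (∑ g)) (∑-δ x (λ _ → c)) ⟩
  ∑ g + c                          ∎
  where open ≡-Reasoning

∑-const-1 : ∀ k → ∑[ i < k ] 1 ≡ k
∑-const-1 zero = refl
∑-const-1 (suc k) = cong suc (∑-const-1 k)

∑-mono-≤ : ∀ {k} {f g : Fin k → ℕ} → (∀ i → f i ≤ g i) → ∑ f ≤ ∑ g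
∑-mono-≤ {zero} f≤g = z≤n
∑-mono-≤ {suc k} f≤g = +-mono-≤ (f≤g zero) (∑-mono-≤ (f≤g ∘ suc))

∑-mono-< : ∀ {k} {f g : Fin k → ℕ} → (∀ i → f i ≤ g i) → ∀ x → f x < g x → ∑ f < ∑ g
∑-mono-< {suc k} f≤g zero fx<gx = +-mono-<-≤ fx<gx (∑-mono-≤ (f≤g ∘ suc))
∑-mono-< {suc k} f≤g (suc x) fx<gx = +-mono-≤-< (f≤g zero) (∑-mono-< (f≤g ∘ suc) x fx<gx)

∑-pos : ∀ {k} (f : Fin k → ℕ) → 0 < ∑ f → ∃ λ i → 0 < f i
∑-pos {suc k} f 0<∑ with f zero in eq
... | suc _ = zero , subst (0 <_) (sym eq) (s≤s z≤n)
... | zero with ∑-pos (f ∘ suc) 0<∑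
...   | i , 0<fᵢ = suc i , 0<fᵢ

-- Walks and simple cycles

module _ {A : Set} where

  data Path (R : A → A → Set) : A → List A → Set where
    []  : ∀ {a} → Path R a []
    _∷_ : ∀ {a b bs} → R a b → Path R b bs → Path R a (b ∷ bs)

  sources : A → List A → List A
  sources a [] = []
  sources a (b ∷ bs) = a ∷ sources b bs

  end : A → List A → A
  end a [] = a
  end a (b ∷ bs) = end b bs

  record Cycle (R : A → A → Set) : Set where
    constructor cycle
    field
      {start}  : A
      {steps}  : List A
      path     : Path R start steps
      closed   : end start steps ≡ start
      simple   : Unique (sources start steps)
      nonempty : 0 < length steps

  module _ {R : A → A → Set} where

    Path-map : ∀ {S : A → A → Set} {c a bs} → (∀ {x y} → c ≢ x → R x y → S x y) →
               All (c ≢_) (sources a bs) → Path R a bs → Path S a bs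
    Path-map f [] [] = []
    Path-map f (c≢a ∷ c≢as) (r ∷ p) = f c≢a r ∷ Path-map f c≢as p

    Path-snoc : ∀ {a bs c} → Path R a bs → R (end a bs) c → Path R a (bs ++ [ c ])
    Path-snoc [] r = r ∷ []
    Path-snoc (r ∷ p) r′ = r ∷ Path-snoc p r′

    Path-prefix : ∀ {a} ys {c zs} → Path R a (ys ++ c ∷ zs) → Path R a (ys ++ [ c ])
    Path-prefix [] (r ∷ _) = r ∷ []
    Path-prefix (y ∷ ys) (r ∷ p) = r ∷ Path-prefix ys p

  end-snoc : ∀ (a : A) ys c → end a (ys ++ [ c ]) ≡ c
  end-snoc a [] c = refl
  end-snoc a (y ∷ ys) c = end-snoc y ys c

  sources-snoc : ∀ (a : A) ys c → sources a (ys ++ [ c ]) ≡ a ∷ ys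
  sources-snoc a [] c = refl
  sources-snoc a (y ∷ ys) c = cong (a ∷_) (sources-snoc y ys c)

  ∈-split-unique : ∀ {a : A} {xs} → a ∈ xs → Unique xs → ∃₂ λ ys zs → xs ≡ ys ++ a ∷ zs × Unique (a ∷ ys)
  ∈-split-unique (here refl) _ = [] , _ , refl , [] ∷ []
  ∈-split-unique (there a∈xs) (x≢xs ∷ u) with ∈-split-unique a∈xs u
  ... | ys , zs , refl , (a≢ys ∷ uys) =
    _ ∷ ys , zs , refl , (a≢x ∷ a≢ys) ∷ (++⁻ˡ ys x≢xs ∷ uys)
    where a≢x = λ a≡x → All.lookup x≢xs (∈-++⁺ʳ ys (here refl)) (sym a≡x)

  Unique⇒lookup-injective : ∀ {xs : List A} → Unique xs → Injective _≡_ _≡_ (lookup xs)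
  Unique⇒lookup-injective (x≢xs ∷ u) {zero} {zero} _ = refl
  Unique⇒lookup-injective (x≢xs ∷ u) {zero} {suc j} x≡xⱼ = contradiction x≡xⱼ (All.lookup x≢xs (∈-lookup j))
  Unique⇒lookup-injective (x≢xs ∷ u) {suc i} {zero} xᵢ≡x = contradiction (sym xᵢ≡x) (All.lookup x≢xs (∈-lookup i))
  Unique⇒lookup-injective (x≢xs ∷ u) {suc i} {suc j} xᵢ≡xⱼ = cong suc (Unique⇒lookup-injective u xᵢ≡xⱼ)

  unique-or-cycle : DecidableEquality A → ∀ {R a bs} → Path R a bs → Unique (a ∷ bs) ⊎ Cycle R
  unique-or-cycle _≟_ [] = inj₁ ([] ∷ [])
  unique-or-cycle _≟_ {R} {a} {b ∷ bs} (r ∷ p) with unique-or-cycle _≟_ p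
  ... | inj₂ c = inj₂ c
  ... | inj₁ u with ∈? _≟_ a (b ∷ bs)
  ...   | no a∉ = inj₁ (¬Any⇒All¬ _ a∉ ∷ u)
  ...   | yes a∈ with ∈-split-unique a∈ u
  ...     | ys , zs , eq , uys =
    inj₂ (cycle (Path-prefix ys (subst (Path R a) eq (r ∷ p))) (end-snoc a ys a)
                (subst Unique (sym (sources-snoc a ys a)) uys) (nonempty ys))
    where
      nonempty : ∀ ys → 0 < length (ys ++ [ a ])
      nonempty [] = s≤s z≤n
      nonempty (_ ∷ _) = s≤s z≤n

Unique⇒length≤ : ∀ {k} {xs : List (Fin k)} → Unique xs → length xs ≤ k
Unique⇒length≤ u = injective⇒≤ (Unique⇒lookup-injective u)

-- Topological orders

-- level t j is the length of a longest walk of length at most t ending at j, and best t j is the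
-- penultimate vertex of such a walk. They are opaque because each level unfolds into two copies
-- of the previous one.
module Levels {k : ℕ} {R : Fin k → Fin k → Set} (R? : Decidable R) where

  score : (Fin k → ℕ) → Fin k → Fin k → ℕ
  score h j i with R? i j
  ... | yes _ = suc (h i)
  ... | no _ = 0

  score-yes : ∀ {h i j} → R i j → score h j i ≡ suc (h i)
  score-yes {h} {i} {j} r with R? i j
  ... | yes _ = refl
  ... | no ¬r = contradiction r ¬r

  score-pos : ∀ {h i j} → 0 < score h j i → R i j × score h j i ≡ suc (h i)
  score-pos {h} {i} {j} _ with R? i j
  score-pos _ | yes r = r , refl

  opaque
    level : ℕ → Fin k → ℕ
    best : ℕ → Fin k → Fin k
    level zero j = 0
    level (suc t) j = score (level t) j (best t j)
    best t j = argmax (score (level t) j) j (allFin k)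

    level-suc : ∀ t j → level (suc t) j ≡ score (level t) j (best t j)
    level-suc t j = refl

    score≤level : ∀ t i j → score (level t) j i ≤ level (suc t) j
    score≤level t i j = All.lookup (f[xs]≤f[argmax] {f = score (level t) j} j (allFin k)) (∈-allFin i)

  level-step : ∀ t {i j} → R i j → suc (level t i) ≤ level (suc t) j
  level-step t {i} {j} r = subst (_≤ level (suc t) j) (score-yes r) (score≤level t i j)

  level-pred : ∀ t j → 0 < level (suc t) j → R (best t j) j × level (suc t) j ≡ suc (level t (best t j))
  level-pred t j 0<l =
    let r , eq = score-pos (subst (0 <_) (level-suc t j) 0<l) in r , trans (level-suc t j) eq

  walk-to : ∀ t j → level t j < level (suc t) j → ∃₂ λ a bs → Path R a bs × length bs ≡ suc t × end a bs ≡ j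
  walk-to zero j lt = best zero j , [ j ] , proj₁ (level-pred zero j (m<n⇒0<n lt)) ∷ [] , refl , refl
  walk-to (suc t) j lt = extend (walk-to t i i-grows)
    where
      i = best (suc t) j
      pred = level-pred (suc t) j (m<n⇒0<n lt)
      r : R i j
      r = proj₁ pred
      i-grows : level t i < level (suc t) i
      i-grows = ≤-trans (level-step t r) (≤-pred (subst (level (suc t) j <_) (proj₂ pred) lt))
      extend : (∃₂ λ a bs → Path R a bs × length bs ≡ suc t × end a bs ≡ i) →
               ∃₂ λ a bs → Path R a bs × length bs ≡ suc (suc t) × end a bs ≡ j
      extend (a , bs , p , len , end≡) =
        a , bs ++ [ j ] , Path-snoc p (subst (λ x → R x j) (sym end≡) r) ,
        trans (length-++ bs) (trans (+-comm (length bs) 1) (cong suc len)) , end-snoc a bs j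

  stable-potential : (∀ j → level (suc k) j ≤ level k j) → ∀ {i j} → R i j → level k i < level k j
  stable-potential stable {i} {j} r = ≤-trans (level-step k r) (stable j)

  long-walk-cycle : ∀ {a bs} → Path R a bs → length bs ≡ suc k → Cycle R
  long-walk-cycle p len with unique-or-cycle _≟_ p
  ... | inj₂ c = c
  ... | inj₁ u = contradiction (subst (λ m → suc m ≤ k) len (Unique⇒length≤ u)) (1+n≰n ∘ ≤-trans (n≤1+n (suc k)))

  cycle-or-potential : Cycle R ⊎ ∃ λ (h : Fin k → ℕ) → ∀ {i j} → R i j → h i < h j
  cycle-or-potential with all? (λ j → level (suc k) j ≤? level k j)
  ... | yes stable = inj₂ (level k , stable-potential stable)
  ... | no unstable with ¬∀⟶∃¬ k _ (λ j → level (suc k) j ≤? level k j) unstable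
  ...   | j , growing with walk-to k j (≰⇒> growing)
  ...     | _ , _ , p , len , _ = inj₁ (long-walk-cycle p len)

injective⇒surjective : ∀ {k} {f : Fin k → Fin k} → Injective _≡_ _≡_ f → Surjective _≡_ _≡_ f
injective⇒surjective {suc m} {f} f-inj y with any? (λ x → f x ≟ y)
... | yes (x , fx≡y) = x , λ { refl → fx≡y }
... | no ∄x = contradiction (injective⇒≤ g-inj) 1+n≰n
  where
    y∉f : ∀ x → y ≢ f x
    y∉f x y≡fx = ∄x (x , sym y≡fx)
    g : Fin (suc m) → Fin m
    g x = punchOut (y∉f x)
    g-inj : Injective _≡_ _≡_ g
    g-inj {x} {z} gx≡gz = f-inj (punchOut-injective (y∉f x) (y∉f z) gx≡gz)

module Ranking {k : ℕ} (h : Fin k → ℕ) where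

  -- the pair (h i , i) in lexicographic order, encoded in ℕ
  key : Fin k → ℕ
  key i = h i *ℕ k + toℕ i

  key-mono : ∀ {i j} → h i < h j → key i < key j
  key-mono {i} {j} hᵢ<hⱼ = begin-strict
    h i *ℕ k + toℕ i  <⟨ +-monoʳ-< (h i *ℕ k) (toℕ<n i) ⟩
    h i *ℕ k + k      ≡⟨ +-comm (h i *ℕ k) k ⟩
    suc (h i) *ℕ k    ≤⟨ *-monoˡ-≤ k hᵢ<hⱼ ⟩
    h j *ℕ k          ≤⟨ m≤m+n (h j *ℕ k) (toℕ j) ⟩
    key j             ∎
    where open ≤-Reasoning

  key-injective : Injective _≡_ _≡_ key
  key-injective {i} {j} kᵢ≡kⱼ with <-cmp (h i) (h j)
  ... | tri< hᵢ<hⱼ _ _ = contradiction kᵢ≡kⱼ (<⇒≢ (key-mono hᵢ<hⱼ))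
  ... | tri> _ _ hⱼ<hᵢ = contradiction (sym kᵢ≡kⱼ) (<⇒≢ (key-mono hⱼ<hᵢ))
  ... | tri≈ _ hᵢ≡hⱼ _ =
    toℕ-injective (+-cancelˡ-≡ (h i *ℕ k) _ _ (trans kᵢ≡kⱼ (cong (λ m → m *ℕ k + toℕ j) (sym hᵢ≡hⱼ))))

  rank : Fin k → ℕ
  rank i = ∑ (λ j → ⟦ does (key j <? key i) ⟧)

  ⟦<?⟧-irrefl : ∀ m → ⟦ does (m <? m) ⟧ ≡ 0
  ⟦<?⟧-irrefl m = cong ⟦_⟧ (dec-false (m <? m) (<-irrefl refl))

  rank<k : ∀ i → rank i < k
  rank<k i = subst (rank i <_) (∑-const-1 k)
    (∑-mono-< (λ j → ⟦⟧≤1 (does (key j <? key i))) i (subst (_< 1) (sym (⟦<?⟧-irrefl (key i))) ≤-refl))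

  rank-mono : ∀ {i j} → key i < key j → rank i < rank j
  rank-mono {i} {j} kᵢ<kⱼ =
    ∑-mono-< (λ x → ⟦does⟧-mono (key x <? key i) (key x <? key j) (λ kₓ<kᵢ → <-trans kₓ<kᵢ kᵢ<kⱼ)) i
      (subst₂ _<_ (sym (⟦<?⟧-irrefl (key i))) (sym (cong ⟦_⟧ (dec-true (key i <? key j) kᵢ<kⱼ))) ≤-refl)

  rank-injective : Injective _≡_ _≡_ rank
  rank-injective {i} {j} rᵢ≡rⱼ with <-cmp (key i) (key j)
  ... | tri< kᵢ<kⱼ _ _ = contradiction rᵢ≡rⱼ (<⇒≢ (rank-mono kᵢ<kⱼ))
  ... | tri≈ _ kᵢ≡kⱼ _ = key-injective kᵢ≡kⱼ
  ... | tri> _ _ kⱼ<kᵢ = contradiction (sym rᵢ≡rⱼ) (<⇒≢ (rank-mono kⱼ<kᵢ))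

  σ : Fin k → Fin k
  σ i = fromℕ< (rank<k i)

  toℕ-σ : ∀ i → toℕ (σ i) ≡ rank i
  toℕ-σ i = toℕ-fromℕ< (rank<k i)

  σ-injective : Injective _≡_ _≡_ σ
  σ-injective σᵢ≡σⱼ = rank-injective (trans (sym (toℕ-σ _)) (trans (cong toℕ σᵢ≡σⱼ) (toℕ-σ _)))

refining-bijection : ∀ {k} (h : Fin k → ℕ) →
  Σ (Fin k ⤖ Fin k) λ σ → ∀ {i j} → h i < h j → Bijection.to σ i <ᶠ Bijection.to σ j
refining-bijection h =
  mk⤖ (σ-injective , injective⇒surjective σ-injective) ,
  λ hᵢ<hⱼ → subst₂ _<_ (sym (toℕ-σ _)) (sym (toℕ-σ _)) (rank-mono (key-mono hᵢ<hⱼ))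
  where open Ranking h

cycle-or-topologicalOrder : ∀ {k} {R : Fin k → Fin k → Set} → Decidable R →
  Cycle R ⊎ Σ (Fin k ⤖ Fin k) λ σ → ∀ {i j} → R i j → Bijection.to σ i <ᶠ Bijection.to σ j
cycle-or-topologicalOrder R? with Levels.cycle-or-potential R?
... | inj₁ c = inj₁ c
... | inj₂ (h , R⇒<) with refining-bijection h
...   | σ , <⇒σ< = inj₂ (σ , <⇒σ< ∘ R⇒<)

-- Counting edges

∧-not-redundant : ∀ a c q → (q ≡ true → c ≡ false) → (a ∧ not c) ∧ q ≡ a ∧ q
∧-not-redundant a c false _ = trans (∧-zeroʳ _) (sym (∧-zeroʳ a))
∧-not-redundant a c true q⇒¬c rewrite q⇒¬c refl = cong (_∧ true) (∧-identityʳ a)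

module _ {k : ℕ} {x y : Fin k} where

  out-indicator : x ≢ y → ∀ i → (x == i) ∧ not (y == i) ≡ (x == i)
  out-indicator x≢y i with x ≟ i
  ... | yes refl = cong not (≢⇒==-false (x≢y ∘ sym))
  ... | no _ = refl

  in-indicator : x ≢ y → ∀ i → not (x == i) ∧ (y == i) ≡ (y == i)
  in-indicator x≢y i with y ≟ i
  ... | yes refl = cong (_∧ true) (cong not (≢⇒==-false x≢y))
  ... | no _ = ∧-zeroʳ _

  out⇒off-diagonal : ∀ {i} → (x == i) ∧ not (y == i) ≡ true → (x == y) ≡ false
  out⇒off-diagonal {i} e with x ≟ i | y ≟ i
  out⇒off-diagonal _  | yes refl | no y≢x = ≢⇒==-false (y≢x ∘ sym)
  out⇒off-diagonal () | yes refl | yes _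
  out⇒off-diagonal () | no _     | _

  in⇒off-diagonal : ∀ {i} → not (x == i) ∧ (y == i) ≡ true → (x == y) ≡ false
  in⇒off-diagonal {i} e with x ≟ i | y ≟ i
  in⇒off-diagonal _  | no x≢y | yes refl = ≢⇒==-false x≢y
  in⇒off-diagonal () | yes _  | _
  in⇒off-diagonal () | no _   | no _

+[m+n]-+[o+p] : ∀ m n o p → + (m + n) - + (o + p) ≡ (+ m - + o) +ᶻ (+ n - + p)
+[m+n]-+[o+p] m n o p rewrite ℤ.pos-+ m n | ℤ.pos-+ o p = rearrange (+ m) (+ n) (+ o) (+ p)
  where
    rearrange : ∀ a b c d → (a +ᶻ b) - (c +ᶻ d) ≡ (a - c) +ᶻ (b - d)
    rearrange = solve-ℤ

⟦∧¬⟧-⟦¬∧⟧ : ∀ x y → + ⟦ x ∧ not y ⟧ - + ⟦ not x ∧ y ⟧ ≡ + ⟦ x ⟧ - + ⟦ y ⟧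
⟦∧¬⟧-⟦¬∧⟧ true  true  = refl
⟦∧¬⟧-⟦¬∧⟧ true  false = refl
⟦∧¬⟧-⟦¬∧⟧ false true  = refl
⟦∧¬⟧-⟦¬∧⟧ false false = refl

⊆ᴰ-refl : ∀ {n} {G : Digraph n} → G ⊆ᴰ G
⊆ᴰ-refl _ _ = id

⊆ᴰ-trans : ∀ {n} {G H K : Digraph n} → G ⊆ᴰ H → H ⊆ᴰ K → G ⊆ᴰ K
⊆ᴰ-trans G⊆H H⊆K u v = H⊆K u v ∘ G⊆H u v

module _ {n : ℕ} where

  countV≡∑ : (p : Fin n → Bool) → countV p ≡ ∑ (⟦_⟧ ∘ p)
  countV≡∑ p = sum-map-tabulate (⟦_⟧ ∘ p) id

  countE≡∑ : (p : Fin n → Fin n → Bool) → countE p ≡ ∑ (countV ∘ p)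
  countE≡∑ p = sum-map-tabulate (countV ∘ p) id

  countV-cong : {p q : Fin n → Bool} → (∀ u → p u ≡ q u) → countV p ≡ countV q
  countV-cong p≡q = cong sum (map-cong (cong ⟦_⟧ ∘ p≡q) (allFin n))

  countE-cong : {p q : Fin n → Fin n → Bool} → (∀ u v → p u v ≡ q u v) → countE p ≡ countE q
  countE-cong p≡q = cong sum (map-cong (countV-cong ∘ p≡q) (allFin n))

  countE-pos : (p : Fin n → Fin n → Bool) → 0 < countE p → ∃₂ λ u v → p u v ≡ true
  countE-pos p 0<c with ∑-pos _ (subst (0 <_) (countE≡∑ p) 0<c)
  ... | u , 0<cᵤ with ∑-pos _ (subst (0 <_) (countV≡∑ (p u)) 0<cᵤ)
  ...   | v , 0<⟦puv⟧ = u , v , ⟦⟧-pos⇒true 0<⟦puv⟧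

  countV-removeAt : (p : Fin n → Bool) (v₀ : Fin n) → countV p ≡ countV (λ v → not (v₀ == v) ∧ p v) + ⟦ p v₀ ⟧
  countV-removeAt p v₀ = begin
    countV p                                       ≡⟨ countV≡∑ p ⟩
    ∑ (⟦_⟧ ∘ p)                                    ≡⟨ ∑-point v₀ ⟦ p v₀ ⟧ split ⟩
    ∑ (λ v → ⟦ not (v₀ == v) ∧ p v ⟧) + ⟦ p v₀ ⟧   ≡⟨ cong (_+ ⟦ p v₀ ⟧) (countV≡∑ _) ⟨
    countV (λ v → not (v₀ == v) ∧ p v) + ⟦ p v₀ ⟧  ∎
    where
      open ≡-Reasoning
      split : ∀ v → ⟦ p v ⟧ ≡ ⟦ not (v₀ == v) ∧ p v ⟧ + ⟦ v₀ == v ⟧ *ℕ ⟦ p v₀ ⟧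
      split v with v₀ ≟ v
      ... | yes refl = sym (*-identityˡ _)
      ... | no _ = sym (+-identityʳ _)

  countE-removeAt : (p : Fin n → Fin n → Bool) (u₀ v₀ : Fin n) →
    countE p ≡ countE (λ u v → not (u₀ == u ∧ v₀ == v) ∧ p u v) + ⟦ p u₀ v₀ ⟧
  countE-removeAt p u₀ v₀ = begin
    countE p                       ≡⟨ countE≡∑ p ⟩
    ∑ (countV ∘ p)                 ≡⟨ ∑-point u₀ ⟦ p u₀ v₀ ⟧ split ⟩
    ∑ (countV ∘ p′) + ⟦ p u₀ v₀ ⟧  ≡⟨ cong (_+ ⟦ p u₀ v₀ ⟧) (countE≡∑ p′) ⟨
    countE p′ + ⟦ p u₀ v₀ ⟧        ∎
    where
      open ≡-Reasoning
      p′ : Fin n → Fin n → Bool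
      p′ u v = not (u₀ == u ∧ v₀ == v) ∧ p u v
      split : ∀ u → countV (p u) ≡ countV (p′ u) + ⟦ u₀ == u ⟧ *ℕ ⟦ p u₀ v₀ ⟧
      split u with u₀ ≟ u
      ... | yes refl = trans (countV-removeAt (p u) v₀)
                             (cong (_+_ (countV (λ v → not (v₀ == v) ∧ p u v))) (sym (*-identityˡ _)))
      ... | no _ = sym (+-identityʳ _)

  deleteEdge : Digraph n → Fin n → Fin n → Digraph n
  adj (deleteEdge G u₀ v₀) u v = not (u₀ == u ∧ v₀ == v) ∧ adj G u v
  loopless (deleteEdge G u₀ v₀) v rewrite loopless G v = ∧-zeroʳ _

  deleteEdge-⊆ : (G : Digraph n) (u₀ v₀ : Fin n) → deleteEdge G u₀ v₀ ⊆ᴰ G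
  deleteEdge-⊆ G u₀ v₀ u v with not (u₀ == u ∧ v₀ == v)
  ... | true = id

  countE-deleteEdge : (G : Digraph n) {u₀ v₀ : Fin n} → adj G u₀ v₀ ≡ true → (q : Fin n → Fin n → Bool) →
    countE (λ u v → adj G u v ∧ q u v) ≡ countE (λ u v → adj (deleteEdge G u₀ v₀) u v ∧ q u v) + ⟦ q u₀ v₀ ⟧
  countE-deleteEdge G {u₀} {v₀} u₀→v₀ q = begin
    countE (λ u v → adj G u v ∧ q u v)
      ≡⟨ countE-removeAt (λ u v → adj G u v ∧ q u v) u₀ v₀ ⟩
    countE (λ u v → not (u₀ == u ∧ v₀ == v) ∧ adj G u v ∧ q u v) + ⟦ adj G u₀ v₀ ∧ q u₀ v₀ ⟧
      ≡⟨ cong₂ _+_ (countE-cong (λ u v → sym (∧-assoc _ (adj G u v) (q u v)))) (cong (λ b → ⟦ b ∧ q u₀ v₀ ⟧) u₀→v₀) ⟩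
    countE (λ u v → adj (deleteEdge G u₀ v₀) u v ∧ q u v) + ⟦ q u₀ v₀ ⟧
      ∎
    where open ≡-Reasoning

  countE-deleteEdge-adj : (G : Digraph n) {u₀ v₀ : Fin n} → adj G u₀ v₀ ≡ true →
    countE (adj G) ≡ suc (countE (adj (deleteEdge G u₀ v₀)))
  countE-deleteEdge-adj G {u₀} {v₀} u₀→v₀ = begin
    countE (adj G)                                            ≡⟨ countE-cong (λ u v → sym (∧-identityʳ (adj G u v))) ⟩
    countE (λ u v → adj G u v ∧ true)                         ≡⟨ countE-deleteEdge G u₀→v₀ (λ _ _ → true) ⟩
    countE (λ u v → adj (deleteEdge G u₀ v₀) u v ∧ true) + 1  ≡⟨ cong (_+ 1) (countE-cong (λ u v → ∧-identityʳ _)) ⟩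
    countE (adj (deleteEdge G u₀ v₀)) + 1                     ≡⟨ +-comm _ 1 ⟩
    suc (countE (adj (deleteEdge G u₀ v₀)))                   ∎
    where open ≡-Reasoning

∑-countE-* : ∀ {n k} (q : Fin k → Fin n → Fin n → Bool) (w : Fin k → ℕ) →
  ∑ (λ i → countE (q i) *ℕ w i) ≡ ∑ (λ u → ∑ (λ v → ∑ (λ i → ⟦ q i u v ⟧ *ℕ w i)))
∑-countE-* {n} {k} q w = begin
  ∑ (λ i → countE (q i) *ℕ w i)                     ≡⟨ sum-cong-≗ {k} expand ⟩
  ∑ (λ i → ∑ (λ u → ∑ (λ v → ⟦ q i u v ⟧ *ℕ w i)))  ≡⟨ ∑-comm {k} {n} _ ⟩
  ∑ (λ u → ∑ (λ i → ∑ (λ v → ⟦ q i u v ⟧ *ℕ w i)))  ≡⟨ sum-cong-≗ {n} (λ u → ∑-comm {k} {n} _) ⟩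
  ∑ (λ u → ∑ (λ v → ∑ (λ i → ⟦ q i u v ⟧ *ℕ w i)))  ∎
  where
    open ≡-Reasoning
    expand : ∀ i → countE (q i) *ℕ w i ≡ ∑ (λ u → ∑ (λ v → ⟦ q i u v ⟧ *ℕ w i))
    expand i = trans (cong (_*ℕ w i) (countE≡∑ (q i))) (trans (*-distribʳ-sum (w i) (countV ∘ q i))
      (sum-cong-≗ {n} λ u → trans (cong (_*ℕ w i) (countV≡∑ (q i u))) (*-distribʳ-sum (w i) (λ v → ⟦ q i u v ⟧))))

module _ {n : ℕ} (G : Digraph n) where

  weight : (Fin n → Fin n → ℕ) → ℕ
  weight f = ∑ (λ u → ∑ (λ v → ⟦ adj G u v ⟧ *ℕ f u v))

  countE-weight : countE (adj G) ≡ weight (λ _ _ → 1)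
  countE-weight = trans (countE≡∑ (adj G)) (sum-cong-≗ {n} λ u →
    trans (countV≡∑ (adj G u)) (sum-cong-≗ {n} λ v → sym (*-identityʳ _)))

  weight-ascent : (f g : Fin n → Fin n → ℕ) → (∀ {u v} → adj G u v ≡ true → f u v < g u v) →
    weight f + countE (adj G) ≤ weight g
  weight-ascent f g f<g = begin
    weight f + countE (adj G)      ≡⟨ cong (_+_ (weight f)) countE-weight ⟩
    weight f + weight (λ _ _ → 1)  ≡⟨ ∑-distrib-+ {n} _ _ ⟨
    ∑ (λ u → ∑ (λ v → ⟦ adj G u v ⟧ *ℕ f u v) + ∑ (λ v → ⟦ adj G u v ⟧ *ℕ 1))
                                   ≡⟨ sum-cong-≗ {n} (λ u → ∑-distrib-+ {n} _ _) ⟨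
    ∑ (λ u → ∑ (λ v → ⟦ adj G u v ⟧ *ℕ f u v + ⟦ adj G u v ⟧ *ℕ 1))
                                   ≤⟨ ∑-mono-≤ (λ u → ∑-mono-≤ (λ v → pointwise u v)) ⟩
    weight g                       ∎
    where
      open ≤-Reasoning
      pointwise : ∀ u v → ⟦ adj G u v ⟧ *ℕ f u v + ⟦ adj G u v ⟧ *ℕ 1 ≤ ⟦ adj G u v ⟧ *ℕ g u v
      pointwise u v with adj G u v in u→v
      ... | false = z≤n
      ... | true rewrite *-identityˡ (f u v) | *-identityˡ (g u v) = subst (_≤ g u v) (+-comm 1 (f u v)) (f<g u→v)

  ∑-countE-labelled : ∀ {k} (q : Fin k → Fin n → Fin n → Bool) (ℓ : Fin n → Fin n → Fin k) (w : Fin k → ℕ) →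
    (∀ {u v} → adj G u v ≡ true → ∀ i → q i u v ≡ (ℓ u v == i)) →
    ∑ (λ i → countE (λ u v → adj G u v ∧ q i u v) *ℕ w i) ≡ weight (λ u v → w (ℓ u v))
  ∑-countE-labelled {k} q ℓ w labelled =
    trans (∑-countE-* (λ i u v → adj G u v ∧ q i u v) w) (sum-cong-≗ {n} λ u → sum-cong-≗ {n} λ v → pointwise u v)
    where
      pointwise : ∀ u v → ∑ (λ i → ⟦ adj G u v ∧ q i u v ⟧ *ℕ w i) ≡ ⟦ adj G u v ⟧ *ℕ w (ℓ u v)
      pointwise u v with adj G u v in u→v
      ... | false = sum-replicate-zero k
      ... | true = trans (sum-cong-≗ {k} λ i → cong (λ b → ⟦ b ⟧ *ℕ w i) (labelled u→v i))
                         (trans (∑-δ (ℓ u v) w) (sym (*-identityˡ _)))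

∑-labels : ∀ {n k} (ℓ : Fin n → Fin k) → ∑ (λ i → countV (λ u → ℓ u == i)) ≡ n
∑-labels {n} {k} ℓ = begin
  ∑ (λ i → countV (λ u → ℓ u == i))  ≡⟨ sum-cong-≗ {k} (λ i → countV≡∑ (λ u → ℓ u == i)) ⟩
  ∑ (λ i → ∑ (λ u → ⟦ ℓ u == i ⟧))   ≡⟨ ∑-comm {k} {n} _ ⟩
  ∑ (λ u → ∑ (λ i → ⟦ ℓ u == i ⟧))   ≡⟨ sum-cong-≗ {n} (λ u → trans (sum-cong-≗ {k} (λ i → sym (*-identityʳ _))) (∑-δ (ℓ u) _)) ⟩
  ∑[ u < n ] 1                       ≡⟨ ∑-const-1 n ⟩
  n                                  ∎
  where open ≡-Reasoning

-- The weighted imbalance bound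

∣+m-+n∣≡m∸n+n∸m : ∀ m n → ∣ + m - + n ∣ ≡ (m ∸ n) + (n ∸ m)
∣+m-+n∣≡m∸n+n∸m m n rewrite ℤ.m-n≡m⊖n m n with ≤-total m n
... | inj₁ m≤n rewrite ℤ.∣⊖∣-≤ m≤n | m≤n⇒m∸n≡0 m≤n = refl
... | inj₂ n≤m rewrite ℤ.∣m⊖n∣≡∣n⊖m∣ m n | ℤ.∣⊖∣-≤ n≤m | m≤n⇒m∸n≡0 n≤m = sym (+-identityʳ _)

m∸n+n≡n∸m+m : ∀ m n → (m ∸ n) + n ≡ (n ∸ m) + m
m∸n+n≡n∸m+m m n with ≤-total m n
... | inj₁ m≤n rewrite m∸n+n≡m m≤n | m≤n⇒m∸n≡0 m≤n = refl
... | inj₂ n≤m rewrite m∸n+n≡m n≤m | m≤n⇒m∸n≡0 n≤m = refl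

∑-scale-+ : ∀ {k} (x y w : Fin k → ℕ) (d : ℕ) →
  ∑ (λ i → (x i + d *ℕ y i) *ℕ w i) ≡ ∑ (λ i → x i *ℕ w i) + d *ℕ ∑ (λ i → y i *ℕ w i)
∑-scale-+ {k} x y w d = begin
  ∑ (λ i → (x i + d *ℕ y i) *ℕ w i)                   ≡⟨ sum-cong-≗ {k} (λ i → distrib (x i) (y i) (w i) d) ⟩
  ∑ (λ i → x i *ℕ w i + d *ℕ (y i *ℕ w i))            ≡⟨ ∑-distrib-+ {k} _ _ ⟩
  ∑ (λ i → x i *ℕ w i) + ∑ (λ i → d *ℕ (y i *ℕ w i))  ≡⟨ cong (_+_ (∑ (λ i → x i *ℕ w i))) (*-distribˡ-sum {k} d _) ⟨
  ∑ (λ i → x i *ℕ w i) + d *ℕ ∑ (λ i → y i *ℕ w i)    ∎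
  where
    open ≡-Reasoning
    distrib : ∀ x y w d → (x + d *ℕ y) *ℕ w ≡ x *ℕ w + d *ℕ (y *ℕ w)
    distrib = solve-ℕ

∑-weighted-≤ : ∀ {k} (w r c : Fin k → ℕ) (K : ℕ) → (∀ i → w i ≤ K) →
  ∑ (λ i → c i *ℕ w i) ≤ ∑ (λ i → r i *ℕ w i) + K *ℕ ∑ (λ i → c i ∸ r i)
∑-weighted-≤ {k} w r c K w≤K = begin
  ∑ (λ i → c i *ℕ w i)                               ≤⟨ ∑-mono-≤ (λ i → pointwise (w i) (r i) (c i) (w≤K i)) ⟩
  ∑ (λ i → r i *ℕ w i + K *ℕ (c i ∸ r i))            ≡⟨ ∑-distrib-+ {k} _ _ ⟩
  ∑ (λ i → r i *ℕ w i) + ∑ (λ i → K *ℕ (c i ∸ r i))  ≡⟨ cong (_+_ (∑ (λ i → r i *ℕ w i))) (*-distribˡ-sum {k} K _) ⟨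
  ∑ (λ i → r i *ℕ w i) + K *ℕ ∑ (λ i → c i ∸ r i)    ∎
  where
    open ≤-Reasoning
    pointwise : ∀ w r c → w ≤ K → c *ℕ w ≤ r *ℕ w + K *ℕ (c ∸ r)
    pointwise w r c w≤K with ≤-total c r
    ... | inj₁ c≤r = ≤-trans (*-monoˡ-≤ w c≤r) (m≤m+n _ _)
    ... | inj₂ r≤c = begin
      c *ℕ w                 ≡⟨ cong (_*ℕ w) (m+[n∸m]≡n r≤c) ⟨
      (r + (c ∸ r)) *ℕ w     ≡⟨ *-distribʳ-+ w r (c ∸ r) ⟩
      r *ℕ w + (c ∸ r) *ℕ w  ≤⟨ +-monoʳ-≤ (r *ℕ w) (*-monoʳ-≤ (c ∸ r) w≤K) ⟩
      r *ℕ w + (c ∸ r) *ℕ K  ≡⟨ cong (_+_ (r *ℕ w)) (*-comm (c ∸ r) K) ⟩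
      r *ℕ w + K *ℕ (c ∸ r)  ∎

∑-∣-∣≡2*∑∸ : ∀ {k} (r c : Fin k → ℕ) → ∑ r ≡ ∑ c → ∑ (λ i → ∣ + r i - + c i ∣) ≡ 2 *ℕ ∑ (λ i → c i ∸ r i)
∑-∣-∣≡2*∑∸ {k} r c ∑r≡∑c = begin
  ∑ (λ i → ∣ + r i - + c i ∣)                ≡⟨ sum-cong-≗ {k} (λ i → ∣+m-+n∣≡m∸n+n∸m (r i) (c i)) ⟩
  ∑ (λ i → (r i ∸ c i) + (c i ∸ r i))        ≡⟨ ∑-distrib-+ {k} _ _ ⟩
  ∑ (λ i → r i ∸ c i) + ∑ (λ i → c i ∸ r i)  ≡⟨ cong (_+ ∑ (λ i → c i ∸ r i)) ∑r∸c≡∑c∸r ⟩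
  ∑ (λ i → c i ∸ r i) + ∑ (λ i → c i ∸ r i)  ≡⟨ cong (_+_ (∑ (λ i → c i ∸ r i))) (+-identityʳ _) ⟨
  2 *ℕ ∑ (λ i → c i ∸ r i)                   ∎
  where
    open ≡-Reasoning
    ∑r∸c≡∑c∸r : ∑ (λ i → r i ∸ c i) ≡ ∑ (λ i → c i ∸ r i)
    ∑r∸c≡∑c∸r = +-cancelʳ-≡ _ _ _ (begin
      ∑ (λ i → r i ∸ c i) + ∑ c    ≡⟨ ∑-distrib-+ {k} _ c ⟨
      ∑ (λ i → (r i ∸ c i) + c i)  ≡⟨ sum-cong-≗ (λ i → m∸n+n≡n∸m+m (r i) (c i)) ⟩
      ∑ (λ i → (c i ∸ r i) + r i)  ≡⟨ ∑-distrib-+ {k} _ r ⟩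
      ∑ (λ i → c i ∸ r i) + ∑ r    ≡⟨ cong (_+_ (∑ (λ i → c i ∸ r i))) ∑r≡∑c ⟩
      ∑ (λ i → c i ∸ r i) + ∑ c    ∎)

imbalance-bound : ∀ {k} (w e⁺ e⁻ r c : Fin k → ℕ) (d K E : ℕ) → (∀ i → w i ≤ K) →
  (∀ i → e⁺ i + d *ℕ c i ≡ e⁻ i + d *ℕ r i) → ∑ r ≡ ∑ c →
  ∑ (λ i → e⁺ i *ℕ w i) + E ≤ ∑ (λ i → e⁻ i *ℕ w i) →
  2 *ℕ E ≤ d *ℕ K *ℕ ∑ (λ i → ∣ + r i - + c i ∣)
imbalance-bound w e⁺ e⁻ r c d K E w≤K balanced ∑r≡∑c ascent = begin
  2 *ℕ E                                 ≤⟨ *-monoʳ-≤ 2 E≤dKT ⟩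
  2 *ℕ (d *ℕ K *ℕ T)                     ≡⟨ reorder d K T ⟩
  d *ℕ K *ℕ (2 *ℕ T)                     ≡⟨ cong (_*ℕ_ (d *ℕ K)) (∑-∣-∣≡2*∑∸ r c ∑r≡∑c) ⟨
  d *ℕ K *ℕ ∑ (λ i → ∣ + r i - + c i ∣)  ∎
  where
    open ≤-Reasoning
    Out = ∑ (λ i → e⁺ i *ℕ w i)
    In  = ∑ (λ i → e⁻ i *ℕ w i)
    WR  = ∑ (λ i → r i *ℕ w i)
    WC  = ∑ (λ i → c i *ℕ w i)
    T   = ∑ (λ i → c i ∸ r i)
    reorder : ∀ d K T → 2 *ℕ (d *ℕ K *ℕ T) ≡ d *ℕ K *ℕ (2 *ℕ T)
    reorder = solve-ℕ
    weighted-balance : Out + d *ℕ WC ≡ In + d *ℕ WR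
    weighted-balance = trans (sym (∑-scale-+ e⁺ c w d))
      (trans (sum-cong-≗ (λ i → cong (_*ℕ w i) (balanced i))) (∑-scale-+ e⁻ r w d))
    E≤dKT : E ≤ d *ℕ K *ℕ T
    E≤dKT = +-cancelˡ-≤ (Out + d *ℕ WR) _ _ (begin
      (Out + d *ℕ WR) + E            ≡⟨ swap Out (d *ℕ WR) E ⟩
      (Out + E) + d *ℕ WR            ≤⟨ +-monoˡ-≤ (d *ℕ WR) ascent ⟩
      In + d *ℕ WR                   ≡⟨ weighted-balance ⟨
      Out + d *ℕ WC                  ≤⟨ +-monoʳ-≤ Out (*-monoʳ-≤ d (∑-weighted-≤ w r c K w≤K)) ⟩
      Out + d *ℕ (WR + K *ℕ T)       ≡⟨ expand Out d WR K T ⟩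
      (Out + d *ℕ WR) + d *ℕ K *ℕ T  ∎)
      where
        swap : ∀ a b c → (a + b) + c ≡ (a + c) + b
        swap = solve-ℕ
        expand : ∀ a d b K t → a + d *ℕ (b + K *ℕ t) ≡ (a + d *ℕ b) + d *ℕ K *ℕ t
        expand = solve-ℕ

balance-ℕ : ∀ a b d r c → + a - + b ≡ + d * (+ r - + c) → a + d *ℕ c ≡ b + d *ℕ r
balance-ℕ a b d r c balanced = ℤ.+-injective (begin
  + (a + d *ℕ c)                           ≡⟨ embed a d c ⟩
  + a +ᶻ + d * + c                         ≡⟨ split (+ a) (+ b) (+ d) (+ c) ⟩
  (+ a - + b) +ᶻ (+ b +ᶻ + d * + c)        ≡⟨ cong (_+ᶻ (+ b +ᶻ + d * + c)) balanced ⟩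
  + d * (+ r - + c) +ᶻ (+ b +ᶻ + d * + c)  ≡⟨ collect (+ b) (+ d) (+ r) (+ c) ⟩
  + b +ᶻ + d * + r                         ≡⟨ embed b d r ⟨
  + (b + d *ℕ r)                           ∎)
  where
    open ≡-Reasoning
    embed : ∀ x y z → + (x + y *ℕ z) ≡ + x +ᶻ + y * + z
    embed x y z = trans (ℤ.pos-+ x _) (cong (_+ᶻ_ (+ x)) (ℤ.pos-* y z))
    split : ∀ a b d c → a +ᶻ d * c ≡ (a - b) +ᶻ (b +ᶻ d * c)
    split = solve-ℤ
    collect : ∀ b d r c → d * (r - c) +ᶻ (b +ᶻ d * c) ≡ b +ᶻ d * r
    collect = solve-ℤ

-- The quotient digraph of a partition

module _ {n k : ℕ} (P : Partition n k) where

  row : Fin n → Fin k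
  row u = proj₁ (P u)

  col : Fin n → Fin k
  col v = proj₂ (P v)

  Arc : Digraph n → Fin k → Fin k → Set
  Arc G a b = 0 < eIJ P G a b

  net : Digraph n → Fin k → ℤ
  net G i = + eOut P G i - + eIn P G i

  Forward : (Fin k ⤖ Fin k) → Digraph n → Set
  Forward σ G = ∀ i j → Bijection.to σ i ≤ᶠ Bijection.to σ j → eIJ P G j i ≡ 0

  net-bip : ∀ G i → net (bip P G) i ≡ net G i
  net-bip G i = cong₂ (λ o e → + o - + e)
    (countE-cong λ u v → ∧-not-redundant (adj G u v) _ _ out⇒off-diagonal)
    (countE-cong λ u v → ∧-not-redundant (adj G u v) _ _ in⇒off-diagonal)

  arc⇒edge : ∀ {G a b} → Arc G a b → ∃₂ λ u v → adj G u v ≡ true × row u ≡ a × col v ≡ b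
  arc⇒edge arc with countE-pos _ arc
  ... | u , v , e with ∧≡true⇒× e
  ...   | u→v , e′ with ∧≡true⇒× e′
  ...     | rowᵤ≡a , colᵥ≡b = u , v , u→v , ==⇒≡ rowᵤ≡a , ==⇒≡ colᵥ≡b

  eIJ-deleteEdge : ∀ {G u₀ v₀} → adj G u₀ v₀ ≡ true → ∀ a b →
    eIJ P G a b ≡ eIJ P (deleteEdge G u₀ v₀) a b + ⟦ (row u₀ == a) ∧ (col v₀ == b) ⟧
  eIJ-deleteEdge {G} u₀→v₀ a b = countE-deleteEdge G u₀→v₀ (λ u v → inRow P a u ∧ inCol P b v)

  edge⇒arc : ∀ {G u v} → adj G u v ≡ true → Arc G (row u) (col v)
  edge⇒arc {G} {u} {v} u→v = subst (0 <_) (sym (eIJ-deleteEdge {G} u→v (row u) (col v)))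
    (subst (λ b → 0 < G′rc + ⟦ b ⟧) (sym (cong₂ _∧_ (==-refl (row u)) (==-refl (col v)))) (m≤n+m 1 G′rc))
    where G′rc = eIJ P (deleteEdge G u v) (row u) (col v)

  arc-deleteEdge : ∀ {G u₀ v₀ a b} → adj G u₀ v₀ ≡ true → row u₀ ≢ a → Arc G a b → Arc (deleteEdge G u₀ v₀) a b
  arc-deleteEdge {G} {u₀} {v₀} {a} {b} u₀→v₀ rowᵤ≢a = subst (0 <_) (begin
    eIJ P G a b                               ≡⟨ eIJ-deleteEdge {G} u₀→v₀ a b ⟩
    G′ab + ⟦ (row u₀ == a) ∧ (col v₀ == b) ⟧  ≡⟨ cong (λ x → G′ab + ⟦ x ∧ (col v₀ == b) ⟧) (≢⇒==-false rowᵤ≢a) ⟩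
    G′ab + 0                                  ≡⟨ +-identityʳ G′ab ⟩
    G′ab                                      ∎)
    where
      open ≡-Reasoning
      G′ab = eIJ P (deleteEdge G u₀ v₀) a b

  -- No off-diagonality is needed: for a diagonal edge both sides change by 0.
  net-deleteEdge : ∀ {G u₀ v₀} → adj G u₀ v₀ ≡ true → ∀ i →
    net G i ≡ net (deleteEdge G u₀ v₀) i +ᶻ (+ ⟦ row u₀ == i ⟧ - + ⟦ col v₀ == i ⟧)
  net-deleteEdge {G} {u₀} {v₀} u₀→v₀ i = begin
    + eOut P G i - + eIn P G i
      ≡⟨ cong₂ (λ o e → + o - + e) (countE-deleteEdge G u₀→v₀ _) (countE-deleteEdge G u₀→v₀ _) ⟩
    + (eOut P G′ i + ⟦ (row u₀ == i) ∧ not (col v₀ == i) ⟧) - + (eIn P G′ i + ⟦ not (row u₀ == i) ∧ (col v₀ == i) ⟧)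
      ≡⟨ +[m+n]-+[o+p] (eOut P G′ i) _ (eIn P G′ i) _ ⟩
    net G′ i +ᶻ (+ ⟦ (row u₀ == i) ∧ not (col v₀ == i) ⟧ - + ⟦ not (row u₀ == i) ∧ (col v₀ == i) ⟧)
      ≡⟨ cong (_+ᶻ_ (net G′ i)) (⟦∧¬⟧-⟦¬∧⟧ (row u₀ == i) (col v₀ == i)) ⟩
    net G′ i +ᶻ (+ ⟦ row u₀ == i ⟧ - + ⟦ col v₀ == i ⟧)
      ∎
    where
      open ≡-Reasoning
      G′ = deleteEdge G u₀ v₀

  -- The net changes telescope along the path.
  deletePath : ∀ G {a bs} → Path (Arc G) a bs → Unique (sources a bs) →
    Σ (Digraph n) λ G′ → G′ ⊆ᴰ G × countE (adj G) ≡ countE (adj G′) + length bs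
      × (∀ i → net G i ≡ net G′ i +ᶻ (+ ⟦ a == i ⟧ - + ⟦ end a bs == i ⟧))
  deletePath G {a} [] _ = G , ⊆ᴰ-refl {G = G} , sym (+-identityʳ _) ,
    λ i → sym (trans (cong (_+ᶻ_ (net G i)) (ℤ.+-inverseʳ (+ ⟦ a == i ⟧))) (ℤ.+-identityʳ _))
  deletePath G {a} {b ∷ bs} (arc ∷ p) (a∉ ∷ simple) with arc⇒edge {G} {a} {b} arc
  ... | u , v , u→v , refl , refl
    with deletePath (deleteEdge G u v) (Path-map (λ {x} {y} → arc-deleteEdge {G} {u} {v} {x} {y} u→v) a∉ p) simple
  ...   | G′ , G′⊆ , count , net≡ =
    G′ , ⊆ᴰ-trans {G = G′} {deleteEdge G u v} {G} G′⊆ (deleteEdge-⊆ G u v) ,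
    trans (countE-deleteEdge-adj G u→v) (trans (cong suc count) (sym (+-suc _ _))) ,
    λ i → trans (net-deleteEdge {G} {u} {v} u→v i) (trans (cong (_+ᶻ (+ ⟦ row u == i ⟧ - + ⟦ col v == i ⟧)) (net≡ i))
                                              (telescope (net G′ i) (+ ⟦ row u == i ⟧) (+ ⟦ col v == i ⟧) (+ ⟦ end (col v) bs == i ⟧)))
    where
      telescope : ∀ x a b c → (x +ᶻ (b - c)) +ᶻ (a - b) ≡ x +ᶻ (a - c)
      telescope = solve-ℤ

  deleteCycle : ∀ G → Cycle (Arc G) →
    Σ (Digraph n) λ G′ → G′ ⊆ᴰ G × countE (adj G′) < countE (adj G) × (∀ i → net G′ i ≡ net G i)
  deleteCycle G (cycle {a} {bs} p closed simple nonempty) with deletePath G p simple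
  ... | G′ , G′⊆G , count , net≡ =
    G′ , G′⊆G , subst (countE (adj G′) <_) (sym count) (m<m+n _ nonempty) ,
    λ i → sym (begin
      net G i                                           ≡⟨ net≡ i ⟩
      net G′ i +ᶻ (+ ⟦ a == i ⟧ - + ⟦ end a bs == i ⟧)  ≡⟨ cong (λ x → net G′ i +ᶻ (+ ⟦ a == i ⟧ - + ⟦ x == i ⟧)) closed ⟩
      net G′ i +ᶻ (+ ⟦ a == i ⟧ - + ⟦ a == i ⟧)         ≡⟨ cong (_+ᶻ_ (net G′ i)) (ℤ.+-inverseʳ (+ ⟦ a == i ⟧)) ⟩
      net G′ i +ᶻ + 0                                   ≡⟨ ℤ.+-identityʳ _ ⟩
      net G′ i                                          ∎)
    where open ≡-Reasoning

  forward-reduction : ∀ G → Σ (Fin k ⤖ Fin k) λ σ → Σ (Digraph n) λ G′ →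
    G′ ⊆ᴰ G × (∀ i → net G′ i ≡ net G i) × Forward σ G′
  forward-reduction G = reduce (suc (countE (adj G))) G ≤-refl
    where
      reduce : ∀ N G → countE (adj G) < N → Σ (Fin k ⤖ Fin k) λ σ → Σ (Digraph n) λ G′ →
        G′ ⊆ᴰ G × (∀ i → net G′ i ≡ net G i) × Forward σ G′
      reduce (suc N) G |G|<N with cycle-or-topologicalOrder (λ a b → 0 <? eIJ P G a b)
      ... | inj₂ (σ , arc⇒σ<) = σ , G , ⊆ᴰ-refl {G = G} , (λ _ → refl) ,
        λ i j σᵢ≤σⱼ → n≤0⇒n≡0 (≮⇒≥ (λ arc → <⇒≱ (arc⇒σ< arc) σᵢ≤σⱼ))
      ... | inj₁ c with deleteCycle G c
      ...   | G₁ , G₁⊆G , fewer , net₁≡ with reduce N G₁ (<-≤-trans fewer (≤-pred |G|<N))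
      ...     | σ , G′ , G′⊆G₁ , net′≡ , forward =
        σ , G′ , ⊆ᴰ-trans {G = G′} {G₁} {G} G′⊆G₁ G₁⊆G , (λ i → trans (net′≡ i) (net₁≡ i)) , forward

  module _ (σ : Fin k ⤖ Fin k) (G : Digraph n) (forward : Forward σ G) where

    position : Fin k → ℕ
    position i = toℕ (Bijection.to σ i)

    edge-ascends : ∀ {u v} → adj G u v ≡ true → position (row u) < position (col v)
    edge-ascends {u} {v} u→v = ≰⇒> λ σc≤σr → <⇒≢ (edge⇒arc {G} u→v) (sym (forward (col v) (row u) σc≤σr))

    forward-ascent : ∑ (λ i → eOut P G i *ℕ position i) + countE (adj G) ≤ ∑ (λ i → eIn P G i *ℕ position i)
    forward-ascent = subst₂ (λ o i → o + countE (adj G) ≤ i)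
      (sym (∑-countE-labelled G _ (λ u _ → row u) position (λ u→v → out-indicator (off-diagonal u→v))))
      (sym (∑-countE-labelled G _ (λ _ v → col v) position (λ u→v → in-indicator (off-diagonal u→v))))
      (weight-ascent G _ _ edge-ascends)
      where
        off-diagonal : ∀ {u v} → adj G u v ≡ true → row u ≢ col v
        off-diagonal u→v rowᵤ≡colᵥ = <-irrefl (cong position rowᵤ≡colᵥ) (edge-ascends u→v)

proposition7p6 : (n k d : ℕ) (G⁰ : Digraph n) (P : Partition n k) →
    (∀ i → (+ eOut P G⁰ i) - (+ eIn P G⁰ i) ≡ + d * ((+ sizeRow P i) - (+ sizeCol P i))) →
    Σ (Fin k ⤖ Fin k) λ σ → Σ (Digraph n) λ G →
      G ⊆ᴰ bip P G⁰
      × 2 *ℕ countE (adj G)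
          ≤ d *ℕ (k ∸ 1) *ℕ sum (map (λ i → ∣ (+ sizeRow P i) - (+ sizeCol P i) ∣) (allFin k))
      × (∀ i → (+ eOut P G i) - (+ eIn P G i) ≡ + d * ((+ sizeRow P i) - (+ sizeCol P i)))
      × (∀ i j → Bijection.to σ i ≤ᶠ Bijection.to σ j → eIJ P G j i ≡ 0)
proposition7p6 n k d G⁰ P balanced with forward-reduction P (bip P G⁰)
... | σ , G , G⊆B , same-net , forward = σ , G , G⊆B , bound , balanced′ , forward
  where
    balanced′ : ∀ i → net P G i ≡ + d * (+ sizeRow P i - + sizeCol P i)
    balanced′ i = trans (same-net i) (trans (net-bip P G⁰ i) (balanced i))
    bound : 2 *ℕ countE (adj G) ≤ d *ℕ (k ∸ 1) *ℕ sum (map (λ i → ∣ + sizeRow P i - + sizeCol P i ∣) (allFin k))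
    bound = subst (λ s → 2 *ℕ countE (adj G) ≤ d *ℕ (k ∸ 1) *ℕ s) (sym (sum-map-tabulate {n = k} _ id))
      (imbalance-bound (position P σ G forward) (eOut P G) (eIn P G) (sizeRow P) (sizeCol P) d (k ∸ 1) (countE (adj G))
        (λ i → <⇒≤pred (toℕ<n _)) (λ i → balance-ℕ _ _ d _ _ (balanced′ i))
        (trans (∑-labels (row P)) (sym (∑-labels (col P)))) (forward-ascent P σ G forward))
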